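{- Let $\mathcal{C}\subseteq\mathbb{N}^N$ be very full and closed under addition and under componentwise maximum $\oplus$. Then every $\oplus$-automorphism $\phi$ of $\mathcal{C}$ that fixes $r\mathbf{1}$ for some positive integer $r$ is permutational.
   Context: $N$ is a finite set, $\mathbb{N}=\{0,1,2,\dots\}$, $e_i$ are the canonical basis vectors, $\mathbf{1}=\sum_i e_i$, and $(u\oplus v)_i=\max(u_i,v_i)$. $S\subseteq\mathbb{R}^N$ is very full if $\mathbf{1}\pm e_i\in S$ for all $i\in N$. A $\oplus$-automorphism of $\mathcal{C}$ is a bijection $\phi:\mathcal{C}\to\mathcal{C}$ with $\phi(u\oplus v)=\phi(u)\oplus\phi(v)$ for all $u,v\in\mathcal{C}$. A bijection $\phi:\mathcal{C}\to\mathcal{C}$ is permutational if there is a permutation $\pi$ of $N$ with $\phi(a)_{\pi(i)}=a_i$ for all $a\in\mathcal{C}$ and $i\in N$. -}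

module Defs where

open import Level using (Level)
open import Data.Nat using (ℕ; _+_; _⊔_; _∸_; _≤_)
open import Data.Fin using (Fin)
open import Data.Fin.Properties using (_≟_)
open import Data.Fin.Permutation using (Permutation′; _⟨$⟩ʳ_)
open import Data.Vec using (Vec; lookup; tabulate; replicate; zipWith)
open import Data.Bool using (if_then_else_)
open import Data.Product using (Σ; Σ-syntax; _×_; _,_; proj₁; ∃)
open import Relation.Nullary.Decidable using (⌊_⌋)
open import Relation.Binary.PropositionalEquality using (_≡_)

-- Vectors in ℕ^N, with N = Fin n.
Vecℕ : ℕ → Set
Vecℕ n = Vec ℕ n

_⊕_ : ∀ {n} → Vecℕ n → Vecℕ n → Vecℕ n
_⊕_ = zipWith _⊔_

_+ᵥ_ : ∀ {n} → Vecℕ n → Vecℕ n → Vecℕ n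
_+ᵥ_ = zipWith _+_

-- componentwise truncated subtraction (only used for 1 - e_i, which stays in ℕ^N)
_-ᵥ_ : ∀ {n} → Vecℕ n → Vecℕ n → Vecℕ n
_-ᵥ_ = zipWith _∸_

e : ∀ {n} → Fin n → Vecℕ n
e i = tabulate (λ j → if ⌊ i ≟ j ⌋ then 1 else 0)

const : ∀ n → ℕ → Vecℕ n
const n r = replicate n r

𝟏 : ∀ {n} → Vecℕ n
𝟏 {n} = const n 1

Subset : ∀ (ℓ : Level) → ℕ → Set _
Subset ℓ n = Vecℕ n → Set ℓ

module _ {ℓ : Level} {n : ℕ} (C : Subset ℓ n) where

  VeryFull : Set ℓ
  VeryFull = ∀ (i : Fin n) → C (𝟏 +ᵥ e i) × C (𝟏 -ᵥ e i)

  ClosedAdd : Set ℓ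
  ClosedAdd = ∀ {u v} → C u → C v → C (u +ᵥ v)

  ClosedMax : Set ℓ
  ClosedMax = ∀ {u v} → C u → C v → C (u ⊕ v)

  El : Set ℓ
  El = Σ (Vecℕ n) C

  module _ (φ : El → El) where

    -- φ is a well-defined function on the set C (independent of membership proofs)
    WellDefined : Set ℓ
    WellDefined = ∀ {u v} (p : C u) (q : C v) → u ≡ v → proj₁ (φ (u , p)) ≡ proj₁ (φ (v , q))

    IsBijection : Set ℓ
    IsBijection =
      (∀ {u v} (p : C u) (q : C v) → proj₁ (φ (u , p)) ≡ proj₁ (φ (v , q)) → u ≡ v)
      × (∀ {v} (q : C v) → Σ[ u ∈ Vecℕ n ] Σ[ p ∈ C u ] proj₁ (φ (u , p)) ≡ v)

    Is⊕Automorphism : ClosedMax → Set ℓ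
    Is⊕Automorphism cl =
      WellDefined × IsBijection
      × (∀ {u v} (p : C u) (q : C v) →
           proj₁ (φ (u ⊕ v , cl p q)) ≡ proj₁ (φ (u , p)) ⊕ proj₁ (φ (v , q)))

    Fixes : Vecℕ n → Set ℓ
    Fixes a = Σ[ p ∈ C a ] proj₁ (φ (a , p)) ≡ a

    Permutational : Set ℓ
    Permutational =
      Σ[ π ∈ Permutation′ n ] (∀ {a} (p : C a) (i : Fin n) →
          lookup (proj₁ (φ (a , p))) (π ⟨$⟩ʳ i) ≡ lookup a i)

-- Since u ≼ v ⇔ u ⊕ v ≡ v, a ⊕-automorphism φ is an automorphism of the poset (C, ≼).
-- For n ≥ 2, C contains 𝟏 and with every (m+1)𝟏 all of its pointwise lower and upper
-- covers (m+1)𝟏 ∓ eᵢ. An order automorphism fixing a point permutes its covers and hence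
-- fixes their meet or join, so fixing r𝟏 forces φ to fix every (m+1)𝟏, and to permute the
-- lower covers of (m+1)𝟏 by some σₘ. As aᵢ ≥ m+1 iff a ⊕ ((m+1)𝟏 − eᵢ) ≡ a ⊕ (m+1)𝟏, this
-- gives φ(a)_{σₘ i} ≥ m+1 iff aᵢ ≥ m+1; testing (m+2)𝟏 − 2eᵢ shows σₘ₊₁ = σₘ, and knowing
-- every threshold of a coordinate determines it. For n = 1, C ⊆ ℕ is well ordered, and an
-- order automorphism of a well order is the identity.

module Submission where

open import Defs
open import Level using (Level; 0ℓ)
open import Data.Bool using (Bool; true; false; if_then_else_)
open import Data.Bool.Properties using (if-float)
open import Data.Empty using (⊥-elim)
open import Data.Fin using (Fin; zero; suc)
open import Data.Fin.Properties using (_≟_; ¬∀⟶∃¬)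
open import Data.Fin.Permutation using (Permutation′; _⟨$⟩ʳ_; permutation)
import Data.Fin.Permutation as Permutation
open import Data.Nat using (ℕ; zero; suc; _+_; _∸_; _≤_; _≥_; _<_; _⊔_; z≤n)
open import Data.Nat.Properties
  using (≤-refl; ≤-reflexive; ≤-trans; ≤-antisym; ≤-pred; <⇒≤; n≤1+n; ≤∧≢⇒<; ≮⇒≥; 1+n≢n; 1+n≰n;
         _≤?_; <-cmp; m≤n⇒m<n∨m≡n; m≤n⇒m⊔n≡n; m≥n⇒m⊔n≡m; m⊔n≡n⇒m≤n; ⊔-idem)
  renaming (_≟_ to _≟ℕ_)
open import Data.Nat.Induction using (<-rec)
open import Data.Product using (Σ-syntax; ∃-syntax; _×_; _,_; proj₁; proj₂; uncurry)
open import Data.Sum using (inj₁; inj₂)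
open import Data.Vec using (lookup; tabulate; replicate; zipWith)
open import Data.Vec.Properties
  using (lookup-zipWith; lookup∘tabulate; lookup-replicate; zipWith-replicate; zipWith-replicate₁;
         tabulate-∘; tabulate-cong)
open import Data.Vec.Relation.Binary.Pointwise.Extensional using (ext; Pointwise-≡⇒≡)
open import Function using (_∘_; flip)
open import Function.Bundles using (_⇔_; mk⇔; Equivalence)
import Function.Properties.Equivalence as ⇔
open import Relation.Binary.Core using (Rel)
open import Relation.Binary.Definitions using (Reflexive; Antisymmetric; tri<; tri≈; tri>)
open import Relation.Nullary using (yes; no)
open import Relation.Nullary.Decidable using (⌊_⌋)
open import Relation.Binary.PropositionalEquality
  using (_≡_; _≢_; refl; sym; trans; cong; cong₂; subst; subst₂; module ≡-Reasoning)

private variable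
  ℓ : Level
  n : ℕ

_at_ : {u v : Vecℕ n} → u ≡ v → (i : Fin n) → lookup u i ≡ lookup v i
eq at i = cong (λ w → lookup w i) eq

lookup-ext : {u v : Vecℕ n} → (∀ i → lookup u i ≡ lookup v i) → u ≡ v
lookup-ext h = Pointwise-≡⇒≡ (ext h)

spike : Fin n → ℕ → ℕ → Vecℕ n
spike i a b = tabulate (λ j → if ⌊ i ≟ j ⌋ then a else b)

lookup-spike : ∀ (i j : Fin n) a b → lookup (spike i a b) j ≡ (if ⌊ i ≟ j ⌋ then a else b)
lookup-spike i j a b = lookup∘tabulate _ j

lookup-spike-≡ : ∀ (i : Fin n) a b → lookup (spike i a b) i ≡ a
lookup-spike-≡ i a b rewrite lookup-spike i i a b with i ≟ i
... | yes _   = refl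
... | no i≢i = ⊥-elim (i≢i refl)

lookup-spike-≢ : ∀ {i j : Fin n} a b → i ≢ j → lookup (spike i a b) j ≡ b
lookup-spike-≢ {i = i} {j} a b i≢j rewrite lookup-spike i j a b with i ≟ j
... | yes i≡j = ⊥-elim (i≢j i≡j)
... | no _    = refl

if-float₂ : ∀ (f : ℕ → ℕ → ℕ) (t : Bool) {a b c d} →
            f (if t then a else b) (if t then c else d) ≡ (if t then f a c else f b d)
if-float₂ f true  = refl
if-float₂ f false = refl

zipWith-spike : ∀ (f : ℕ → ℕ → ℕ) (i : Fin n) a b c d →
                zipWith f (spike i a b) (spike i c d) ≡ spike i (f a c) (f b d)
zipWith-spike f i a b c d = lookup-ext λ j → begin
  lookup (zipWith f (spike i a b) (spike i c d)) j             ≡⟨ lookup-zipWith f j (spike i a b) (spike i c d) ⟩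
  f (lookup (spike i a b) j) (lookup (spike i c d) j)          ≡⟨ cong₂ f (lookup-spike i j a b) (lookup-spike i j c d) ⟩
  f (if ⌊ i ≟ j ⌋ then a else b) (if ⌊ i ≟ j ⌋ then c else d)  ≡⟨ if-float₂ f ⌊ i ≟ j ⌋ ⟩
  (if ⌊ i ≟ j ⌋ then f a c else f b d)                         ≡⟨ lookup-spike i j _ _ ⟨
  lookup (spike i (f a c) (f b d)) j                           ∎
  where open ≡-Reasoning

zipWith-replicate-spike : ∀ (f : ℕ → ℕ → ℕ) k (i : Fin n) a b →
                          zipWith f (replicate n k) (spike i a b) ≡ spike i (f k a) (f k b)
zipWith-replicate-spike f k i a b = trans (zipWith-replicate₁ f k _)
  (trans (sym (tabulate-∘ (f k) _)) (tabulate-cong λ j → if-float (f k) ⌊ i ≟ j ⌋))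

spike-⊕-spike : ∀ {i j : Fin n} {a b} → i ≢ j → a ≤ b → spike i a b ⊕ spike j a b ≡ const n b
spike-⊕-spike {i = i} {j} {a} {b} i≢j a≤b = lookup-ext pointwise
  where
  pointwise : ∀ k → lookup (spike i a b ⊕ spike j a b) k ≡ lookup (const _ b) k
  pointwise k rewrite lookup-zipWith _⊔_ k (spike i a b) (spike j a b)
                    | lookup-spike i k a b | lookup-spike j k a b | lookup-replicate k b
    with i ≟ k | j ≟ k
  ... | yes i≡k | yes j≡k = ⊥-elim (i≢j (trans i≡k (sym j≡k)))
  ... | yes _   | no _    = m≤n⇒m⊔n≡n a≤b
  ... | no _    | yes _   = m≥n⇒m⊔n≡m a≤b
  ... | no _    | no _    = ⊔-idem b

𝟏+e≡spike : ∀ (i : Fin n) → 𝟏 +ᵥ e i ≡ spike i 2 1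
𝟏+e≡spike i = zipWith-replicate-spike _+_ 1 i 1 0

𝟏-e≡spike : ∀ (i : Fin n) → 𝟏 -ᵥ e i ≡ spike i 0 1
𝟏-e≡spike i = zipWith-replicate-spike _∸_ 1 i 1 0

_≼[_]_ : Vecℕ n → Rel ℕ 0ℓ → Vecℕ n → Set
u ≼[ R ] v = ∀ i → R (lookup u i) (lookup v i)

_≼_ : Vecℕ n → Vecℕ n → Set
u ≼ v = u ≼[ _≤_ ] v

≼-antisym : {u v : Vecℕ n} → u ≼ v → v ≼ u → u ≡ v
≼-antisym u≼v v≼u = lookup-ext λ i → ≤-antisym (u≼v i) (v≼u i)

≼-reflexive : {u v : Vecℕ n} → u ≡ v → u ≼ v
≼-reflexive u≡v i = ≤-reflexive (u≡v at i)

≼⇒⊕≡ : {u v : Vecℕ n} → u ≼ v → u ⊕ v ≡ v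
≼⇒⊕≡ {u = u} {v} u≼v = lookup-ext λ i → trans (lookup-zipWith _⊔_ i u v) (m≤n⇒m⊔n≡n (u≼v i))

⊕≡⇒≼ : {u v : Vecℕ n} → u ⊕ v ≡ v → u ≼ v
⊕≡⇒≼ {u = u} {v} u⊕v≡v i = m⊔n≡n⇒m≤n (trans (sym (lookup-zipWith _⊔_ i u v)) (u⊕v≡v at i))

IsGlb : (_⊑_ : Rel (Vecℕ n) 0ℓ) → Vecℕ n → (Fin n → Vecℕ n) → Set
IsGlb _⊑_ s c = (∀ i → s ⊑ c i) × (∀ {x} → (∀ i → x ⊑ c i) → x ⊑ s)

record LowerCovers (_⊑_ : Rel (Vecℕ n) 0ℓ) (t : Vecℕ n) (c : Fin n → Vecℕ n) : Set where
  field
    cover-below      : ∀ i → c i ⊑ t × c i ≢ t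
    below-some-cover : ∀ {u} → u ⊑ t → u ≢ t → ∃[ j ] u ⊑ c j
    cover-maximal    : ∀ {u} i → c i ⊑ u → u ⊑ t → u ≢ t → u ≡ c i
    incomparable     : ∀ {i j} → c i ⊑ c j → i ≡ j

module _ {R : Rel ℕ 0ℓ} (R-refl : Reflexive R) (R-antisym : Antisymmetric _≡_ R) where

  replicate-glb-spikes : ∀ {a b} → R a b → IsGlb (_≼[ R ]_) (const n a) (λ i → spike i a b)
  replicate-glb-spikes {n = n} {a} {b} aRb = below , λ {x} → greatest {x}
    where
    below : ∀ i → const n a ≼[ R ] spike i a b
    below i j rewrite lookup-replicate j a | lookup-spike i j a b with ⌊ i ≟ j ⌋
    ... | true  = R-refl
    ... | false = aRb
    greatest : ∀ {x} → (∀ i → x ≼[ R ] spike i a b) → x ≼[ R ] const n a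
    greatest {x} x≼spikes j =
      subst (R (lookup x j)) (trans (lookup-spike-≡ j a b) (sym (lookup-replicate j a))) (x≼spikes j j)

  -- k′ is the immediate R-predecessor of k, so the spikes are the R-lower covers of const n k.
  spikes-lowerCovers : ∀ {k k′} → R k′ k → k′ ≢ k → (∀ {x} → R x k → x ≢ k → R x k′) →
                       LowerCovers (_≼[ R ]_) (const n k) (λ i → spike i k′ k)
  spikes-lowerCovers {n = n} {k} {k′} k′Rk k′≢k R-pred = record
    { cover-below      = λ i → spike≼top i , spike≢top i
    ; below-some-cover = below-some-cover
    ; cover-maximal    = cover-maximal
    ; incomparable     = incomparable
    }
    where
    top : Vecℕ n
    top = const n k

    ≡top : ∀ {u} → (∀ j → lookup u j ≡ k) → u ≡ top
    ≡top all-k = lookup-ext λ j → trans (all-k j) (sym (lookup-replicate j k))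

    ≼top⇒R : ∀ {u} → u ≼[ R ] top → ∀ j → R (lookup u j) k
    ≼top⇒R u≼t j = subst (R _) (lookup-replicate j k) (u≼t j)

    spike≼top : ∀ i → spike i k′ k ≼[ R ] top
    spike≼top i j rewrite lookup-replicate j k | lookup-spike i j k′ k with ⌊ i ≟ j ⌋
    ... | true  = k′Rk
    ... | false = R-refl

    spike≢top : ∀ i → spike i k′ k ≢ top
    spike≢top i eq = k′≢k (trans (sym (lookup-spike-≡ i k′ k)) (trans (eq at i) (lookup-replicate i k)))

    below-some-cover : ∀ {u} → u ≼[ R ] top → u ≢ top → ∃[ j ] u ≼[ R ] spike j k′ k
    below-some-cover {u} u≼t u≢t with ¬∀⟶∃¬ n (λ j → lookup u j ≡ k) (λ j → lookup u j ≟ℕ k) (u≢t ∘ ≡top)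
    ... | j , uj≢k = j , u≼spike
      where
      u≼spike : u ≼[ R ] spike j k′ k
      u≼spike l rewrite lookup-spike j l k′ k with j ≟ l
      ... | yes refl = R-pred (≼top⇒R {u} u≼t j) uj≢k
      ... | no _     = ≼top⇒R {u} u≼t l

    cover-maximal : ∀ {u} i → spike i k′ k ≼[ R ] u → u ≼[ R ] top → u ≢ top → u ≡ spike i k′ k
    cover-maximal {u} i spike≼u u≼t u≢t = lookup-ext pointwise
      where
      off-i : ∀ {j} → i ≢ j → lookup u j ≡ k
      off-i {j} i≢j = R-antisym (≼top⇒R {u} u≼t j)
                                (subst (flip R (lookup u j)) (lookup-spike-≢ k′ k i≢j) (spike≼u j))
      ui≢k : lookup u i ≢ k
      ui≢k ui≡k = u≢t (≡top on-j)
        where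
        on-j : ∀ j → lookup u j ≡ k
        on-j j with i ≟ j
        ... | yes refl = ui≡k
        ... | no i≢j   = off-i i≢j
      pointwise : ∀ j → lookup u j ≡ lookup (spike i k′ k) j
      pointwise j rewrite lookup-spike i j k′ k with i ≟ j
      ... | yes refl = R-antisym (R-pred (≼top⇒R {u} u≼t i) ui≢k)
                                 (subst (flip R (lookup u i)) (lookup-spike-≡ i k′ k) (spike≼u i))
      ... | no i≢j   = off-i i≢j

    incomparable : ∀ {i j} → spike i k′ k ≼[ R ] spike j k′ k → i ≡ j
    incomparable {i} {j} spike-i≼spike-j with i ≟ j
    ... | yes i≡j = i≡j
    ... | no i≢j  = ⊥-elim (k′≢k (R-antisym k′Rk
                      (subst₂ R (lookup-spike-≢ k′ k i≢j) (lookup-spike-≡ j k′ k) (spike-i≼spike-j j))))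

threshold⇔⊕ : ∀ (x : Vecℕ n) i m →
              suc m ≤ lookup x i ⇔ (x ⊕ spike i m (suc m) ≡ x ⊕ const n (suc m))
threshold⇔⊕ {n} x i m = mk⇔ to from
  where
  to : suc m ≤ lookup x i → x ⊕ spike i m (suc m) ≡ x ⊕ const n (suc m)
  to m<xi = lookup-ext pointwise
    where
    pointwise : ∀ j → lookup (x ⊕ spike i m (suc m)) j ≡ lookup (x ⊕ const n (suc m)) j
    pointwise j rewrite lookup-zipWith _⊔_ j x (spike i m (suc m))
                      | lookup-zipWith _⊔_ j x (const n (suc m))
                      | lookup-spike i j m (suc m) | lookup-replicate j (suc m)
                      with i ≟ j
    ... | yes refl = trans (m≥n⇒m⊔n≡m (≤-trans (n≤1+n m) m<xi)) (sym (m≥n⇒m⊔n≡m m<xi))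
    ... | no _     = refl

  from : x ⊕ spike i m (suc m) ≡ x ⊕ const n (suc m) → suc m ≤ lookup x i
  from eq with suc m ≤? lookup x i
  ... | yes m<xi = m<xi
  ... | no m≮xi  = ⊥-elim (1+n≢n (begin
      suc m                                      ≡⟨ m≤n⇒m⊔n≡n (≤-trans xi≤m (n≤1+n m)) ⟨
      lookup x i ⊔ suc m                         ≡⟨ cong (lookup x i ⊔_) (lookup-replicate i (suc m)) ⟨
      lookup x i ⊔ lookup (const n (suc m)) i    ≡⟨ lookup-zipWith _⊔_ i x (const n (suc m)) ⟨
      lookup (x ⊕ const n (suc m)) i             ≡⟨ eq at i ⟨
      lookup (x ⊕ spike i m (suc m)) i           ≡⟨ lookup-zipWith _⊔_ i x (spike i m (suc m)) ⟩
      lookup x i ⊔ lookup (spike i m (suc m)) i  ≡⟨ cong (lookup x i ⊔_) (lookup-spike-≡ i m (suc m)) ⟩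
      lookup x i ⊔ m                             ≡⟨ m≤n⇒m⊔n≡n xi≤m ⟩
      m                                          ∎))
    where
    open ≡-Reasoning
    xi≤m : lookup x i ≤ m
    xi≤m = ≮⇒≥ m≮xi

≡-from-thresholds : ∀ {x y} → (∀ m → suc m ≤ x ⇔ suc m ≤ y) → x ≡ y
≡-from-thresholds same = ≤-antisym (≤-from-thresholds same) (≤-from-thresholds (⇔.sym ∘ same))
  where
  ≤-from-thresholds : ∀ {x y} → (∀ m → suc m ≤ x ⇔ suc m ≤ y) → x ≤ y
  ≤-from-thresholds {zero}  _     = z≤n
  ≤-from-thresholds {suc x} same′ = Equivalence.to (same′ x) ≤-refl

holds-everywhere : (P : ℕ → Set ℓ) → (∀ m → P (suc m) → P m) → (∀ m → P m → P (suc m)) →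
                   ∀ r → P r → ∀ m → P m
holds-everywhere P down up r Pr m = climb m (descend r Pr)
  where
  descend : ∀ r → P r → P 0
  descend zero    P0  = P0
  descend (suc r) Psr = descend r (down r Psr)
  climb : ∀ m → P 0 → P m
  climb zero    P0 = P0
  climb (suc m) P0 = up m (climb m P0)

module ⊕-Automorphism {ℓ : Level} {n : ℕ} {C : Subset ℓ n} {cl : ClosedMax C} {φ : El C → El C}
                      (aut : Is⊕Automorphism C φ cl) where

  F : ∀ u → C u → Vecℕ n
  F u p = proj₁ (φ (u , p))

  F-cong : ∀ {u v} (p : C u) (q : C v) → u ≡ v → F u p ≡ F v q
  F-cong = proj₁ aut

  F-injective : ∀ {u v} (p : C u) (q : C v) → F u p ≡ F v q → u ≡ v
  F-injective = proj₁ (proj₁ (proj₂ aut))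

  F-surjective : ∀ {v} (q : C v) → ∃[ u ] Σ[ p ∈ C u ] F u p ≡ v
  F-surjective = proj₂ (proj₁ (proj₂ aut))

  F-⊕ : ∀ {u v} (p : C u) (q : C v) → F (u ⊕ v) (cl p q) ≡ F u p ⊕ F v q
  F-⊕ = proj₂ (proj₂ aut)

  F-mono : ∀ {u v} (p : C u) (q : C v) → u ≼ v → F u p ≼ F v q
  F-mono p q u≼v = ⊕≡⇒≼ (trans (sym (F-⊕ p q)) (F-cong (cl p q) q (≼⇒⊕≡ u≼v)))

  F-reflects : ∀ {u v} (p : C u) (q : C v) → F u p ≼ F v q → u ≼ v
  F-reflects p q Fu≼Fv = ⊕≡⇒≼ (F-injective (cl p q) q (trans (F-⊕ p q) (≼⇒⊕≡ Fu≼Fv)))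

  ⊕-equation-transport : ∀ {a x y x′ y′} (pa : C a) (px : C x) (py : C y) →
                         F x px ≡ x′ → F y py ≡ y′ →
                         (a ⊕ x ≡ a ⊕ y) ⇔ (F a pa ⊕ x′ ≡ F a pa ⊕ y′)
  ⊕-equation-transport {a} {x} {y} {x′} {y′} pa px py Fx≡x′ Fy≡y′ = mk⇔ to from
    where
    open ≡-Reasoning
    to : a ⊕ x ≡ a ⊕ y → F a pa ⊕ x′ ≡ F a pa ⊕ y′
    to eq = begin
      F a pa ⊕ x′           ≡⟨ cong (F a pa ⊕_) Fx≡x′ ⟨
      F a pa ⊕ F x px       ≡⟨ F-⊕ pa px ⟨
      F (a ⊕ x) (cl pa px)  ≡⟨ F-cong (cl pa px) (cl pa py) eq ⟩
      F (a ⊕ y) (cl pa py)  ≡⟨ F-⊕ pa py ⟩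
      F a pa ⊕ F y py       ≡⟨ cong (F a pa ⊕_) Fy≡y′ ⟩
      F a pa ⊕ y′           ∎
    from : F a pa ⊕ x′ ≡ F a pa ⊕ y′ → a ⊕ x ≡ a ⊕ y
    from eq = F-injective (cl pa px) (cl pa py) (begin
      F (a ⊕ x) (cl pa px)  ≡⟨ F-⊕ pa px ⟩
      F a pa ⊕ F x px       ≡⟨ cong (F a pa ⊕_) Fx≡x′ ⟩
      F a pa ⊕ x′           ≡⟨ eq ⟩
      F a pa ⊕ y′           ≡⟨ cong (F a pa ⊕_) Fy≡y′ ⟨
      F a pa ⊕ F y py       ≡⟨ F-⊕ pa py ⟨
      F (a ⊕ y) (cl pa py)  ∎)

  Permutes : (c : Fin n → Vecℕ n) → (∀ i → C (c i)) → Set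
  Permutes c pc = (∀ i → ∃[ j ] F (c i) (pc i) ≡ c j) × (∀ j → ∃[ i ] F (c i) (pc i) ≡ c j)

  permutation-of : ∀ {c : Fin n → Vecℕ n} (pc : ∀ i → C (c i)) → (∀ {i j} → c i ≡ c j → i ≡ j) →
                   Permutes c pc → Σ[ π ∈ Permutation′ n ] (∀ i → F (c i) (pc i) ≡ c (π ⟨$⟩ʳ i))
  permutation-of pc c-injective (forth , back) = permutation f g f∘g g∘f , proj₂ ∘ forth
    where
    f g : Fin n → Fin n
    f = proj₁ ∘ forth
    g = proj₁ ∘ back
    f∘g : ∀ j → f (g j) ≡ j
    f∘g j = c-injective (trans (sym (proj₂ (forth (g j)))) (proj₂ (back j)))
    g∘f : ∀ i → g (f i) ≡ i
    g∘f i = c-injective (F-injective (pc (g (f i))) (pc i)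
                                     (trans (proj₂ (back (f i))) (sym (proj₂ (forth i)))))

  -- Stated for an abstract order so that it applies to both ≼ and its dual.
  module OrderAutomorphism (_⊑_ : Rel (Vecℕ n) 0ℓ)
    (mono    : ∀ {u v} (p : C u) (q : C v) → u ⊑ v → F u p ⊑ F v q)
    (reflect : ∀ {u v} (p : C u) (q : C v) → F u p ⊑ F v q → u ⊑ v)
    where

    module _ {t : Vecℕ n} (pt : C t) (t-fixed : F t pt ≡ t)
             {c : Fin n → Vecℕ n} (pc : ∀ i → C (c i)) (covers : LowerCovers _⊑_ t c) where
      open LowerCovers covers

      F-below : ∀ {u} (p : C u) → u ⊑ t → u ≢ t → F u p ⊑ t × F u p ≢ t
      F-below p u⊑t u≢t = subst (F _ p ⊑_) t-fixed (mono p pt u⊑t)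
                        , λ Fu≡t → u≢t (F-injective p pt (trans Fu≡t (sym t-fixed)))

      F-below⁻ : ∀ {u} (p : C u) → F u p ⊑ t → F u p ≢ t → u ⊑ t × u ≢ t
      F-below⁻ p Fu⊑t Fu≢t = reflect p pt (subst (F _ p ⊑_) (sym t-fixed) Fu⊑t)
                           , λ u≡t → Fu≢t (trans (F-cong p pt u≡t) t-fixed)

      F-permutes-covers : Permutes c pc
      F-permutes-covers = forth , back
        where
        preimage-below : ∀ {u} (p : C u) {j} → F u p ≡ c j → u ⊑ t × u ≢ t
        preimage-below p {j} Fu≡cj = F-below⁻ p (subst (_⊑ t) (sym Fu≡cj) (proj₁ (cover-below j)))
                                                 (λ Fu≡t → proj₂ (cover-below j) (trans (sym Fu≡cj) Fu≡t))

        forth : ∀ i → ∃[ j ] F (c i) (pc i) ≡ c j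
        forth i with uncurry below-some-cover (uncurry (F-below (pc i)) (cover-below i))
        ... | j , Fci⊑cj with F-surjective (pc j)
        ...   | u , pu , Fu≡cj = j , trans (F-cong (pc i) pu (sym u≡ci)) Fu≡cj
          where
          ci⊑u : c i ⊑ u
          ci⊑u = reflect (pc i) pu (subst (F (c i) (pc i) ⊑_) (sym Fu≡cj) Fci⊑cj)
          u≡ci : u ≡ c i
          u≡ci = uncurry (cover-maximal i ci⊑u) (preimage-below pu Fu≡cj)

        back : ∀ j → ∃[ i ] F (c i) (pc i) ≡ c j
        back j with F-surjective (pc j)
        ... | u , pu , Fu≡cj with uncurry below-some-cover (preimage-below pu Fu≡cj)
        ...   | i , u⊑ci with forth i
        ...     | j′ , Fci≡cj′ = i , trans Fci≡cj′ (cong c (sym j≡j′))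
          where
          j≡j′ : j ≡ j′
          j≡j′ = incomparable (subst₂ _⊑_ Fu≡cj Fci≡cj′ (mono pu (pc i) u⊑ci))

    F-fixes-glb : (∀ {u v} → u ⊑ v → v ⊑ u → u ≡ v) →
                  ∀ {c : Fin n → Vecℕ n} (pc : ∀ i → C (c i)) → Permutes c pc →
                  ∀ {s} (ps : C s) → IsGlb _⊑_ s c → F s ps ≡ s
    F-fixes-glb antisym pc (forth , back) {s} ps (s⊑c , greatest) with F-surjective ps
    ... | u , pu , Fu≡s = antisym Fs⊑s s⊑Fs
      where
      Fs⊑s : F s ps ⊑ s
      Fs⊑s = greatest λ j → subst (F s ps ⊑_) (proj₂ (back j)) (mono ps (pc (proj₁ (back j))) (s⊑c _))
      u⊑s : u ⊑ s
      u⊑s = greatest λ i → reflect pu (pc i) (subst₂ _⊑_ (sym Fu≡s) (sym (proj₂ (forth i))) (s⊑c _))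
      s⊑Fs : s ⊑ F s ps
      s⊑Fs = subst (_⊑ F s ps) Fu≡s (mono pu ps u⊑s)

module Staircase {ℓ : Level} {n : ℕ} {C : Subset ℓ n} {cl : ClosedMax C} {φ : El C → El C}
                 (aut : Is⊕Automorphism C φ cl)
                 (very-full : VeryFull C) (closed-add : ClosedAdd C) (𝟏∈C : C 𝟏) where
  open ⊕-Automorphism {C = C} {cl = cl} {φ = φ} aut

  -- diag m = (m+1)𝟏,  lower m i = diag m − eᵢ,  upper m i = diag m + eᵢ,  notch m i = (m+2)𝟏 − 2eᵢ.
  diag : ℕ → Vecℕ n
  diag m = const n (suc m)

  lower upper notch : ℕ → Fin n → Vecℕ n
  lower m i = spike i m (suc m)
  upper m i = spike i (suc (suc m)) (suc m)
  notch m i = spike i m (suc (suc m))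

  𝟏+-∈C : ∀ {u} → C u → C (𝟏 +ᵥ u)
  𝟏+-∈C = closed-add 𝟏∈C

  𝟏+spike : ∀ (i : Fin n) a b → 𝟏 +ᵥ spike i a b ≡ spike i (suc a) (suc b)
  𝟏+spike = zipWith-replicate-spike _+_ 1

  diag∈C : ∀ m → C (diag m)
  diag∈C zero    = 𝟏∈C
  diag∈C (suc m) = subst C (zipWith-replicate _+_ 1 (suc m)) (𝟏+-∈C (diag∈C m))

  lower∈C : ∀ m i → C (lower m i)
  lower∈C zero    i = subst C (𝟏-e≡spike i) (proj₂ (very-full i))
  lower∈C (suc m) i = subst C (𝟏+spike i m (suc m)) (𝟏+-∈C (lower∈C m i))

  upper∈C : ∀ m i → C (upper m i)
  upper∈C zero    i = subst C (𝟏+e≡spike i) (proj₁ (very-full i))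
  upper∈C (suc m) i = subst C (𝟏+spike i (suc (suc m)) (suc m)) (𝟏+-∈C (upper∈C m i))

  notch∈C : ∀ m i → C (notch m i)
  notch∈C zero    i = subst C (zipWith-spike _+_ i 0 1 0 1) (closed-add (lower∈C 0 i) (lower∈C 0 i))
  notch∈C (suc m) i = subst C (𝟏+spike i m (suc (suc m))) (𝟏+-∈C (notch∈C m i))

  _≽_ : Vecℕ n → Vecℕ n → Set
  u ≽ v = u ≼[ _≥_ ] v

  lower-covers : ∀ m → LowerCovers _≼_ (diag m) (lower m)
  lower-covers m = spikes-lowerCovers ≤-refl ≤-antisym (n≤1+n m) (1+n≢n ∘ sym)
                                      (λ x≤1+m x≢1+m → ≤-pred (≤∧≢⇒< x≤1+m x≢1+m))

  upper-covers : ∀ m → LowerCovers _≽_ (diag m) (upper m)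
  upper-covers m = spikes-lowerCovers ≤-refl (flip ≤-antisym) (n≤1+n (suc m)) 1+n≢n
                                      (λ 1+m≤x x≢1+m → ≤∧≢⇒< 1+m≤x (x≢1+m ∘ sym))

  module Below = OrderAutomorphism _≼_ F-mono F-reflects
  module Above = OrderAutomorphism _≽_ (flip F-mono) (flip F-reflects)

  DiagFixed : ℕ → Set
  DiagFixed m = F (diag m) (diag∈C m) ≡ diag m

  lower-covers-permuted : ∀ m → DiagFixed m → Permutes (lower m) (lower∈C m)
  lower-covers-permuted m fixed = Below.F-permutes-covers (diag∈C m) fixed (lower∈C m) (lower-covers m)

  DiagFixed-pred : ∀ m → DiagFixed (suc m) → DiagFixed m
  DiagFixed-pred m fixed = Below.F-fixes-glb ≼-antisym
    (lower∈C (suc m)) (lower-covers-permuted (suc m) fixed)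
    (diag∈C m) (replicate-glb-spikes ≤-refl ≤-antisym (n≤1+n (suc m)))

  DiagFixed-suc : ∀ m → DiagFixed m → DiagFixed (suc m)
  DiagFixed-suc m fixed = Above.F-fixes-glb (flip ≼-antisym)
    (upper∈C m) (Above.F-permutes-covers (diag∈C m) fixed (upper∈C m) (upper-covers m))
    (diag∈C (suc m)) (replicate-glb-spikes ≤-refl (flip ≤-antisym) (n≤1+n (suc m)))

  all-diag-fixed : ∀ r → Fixes C φ (diag r) → ∀ m → DiagFixed m
  all-diag-fixed r (pr , r-fixed) =
    holds-everywhere DiagFixed DiagFixed-pred DiagFixed-suc r (trans (F-cong (diag∈C r) pr refl) r-fixed)

  Sends : ℕ → Fin n → Fin n → Set
  Sends m i j = F (lower m i) (lower∈C m i) ≡ lower m j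

  F-preserves-threshold : ∀ {m i j} → DiagFixed m → Sends m i j →
                          ∀ {a} (pa : C a) → suc m ≤ lookup a i ⇔ suc m ≤ lookup (F a pa) j
  F-preserves-threshold {m} {i} {j} fixed sends {a} pa =
    ⇔.trans (threshold⇔⊕ a i m)
   (⇔.trans (⊕-equation-transport pa (lower∈C m i) (diag∈C m) sends fixed)
            (⇔.sym (threshold⇔⊕ (F a pa) j m)))

  -- Were i′ ≢ i sent to j at level m+1, the notch at i (m+2 at i′, only m at i) would break level m.
  Sends-suc : ∀ {m i j} → DiagFixed m → DiagFixed (suc m) → Sends m i j → Sends (suc m) i j
  Sends-suc {m} {i} {j} fixed fixed′ sends = uncurry settle (proj₂ (lower-covers-permuted (suc m) fixed′) j)
    where
    settle : ∀ i′ → Sends (suc m) i′ j → Sends (suc m) i j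
    settle i′ sends′ with i′ ≟ i
    ... | yes refl = sends′
    ... | no i′≢i  = ⊥-elim (1+n≰n notch-high-at-i)
      where
      image-high-at-j : suc (suc m) ≤ lookup (F (notch m i) (notch∈C m i)) j
      image-high-at-j = Equivalence.to (F-preserves-threshold fixed′ sends′ (notch∈C m i))
                          (≤-reflexive (sym (lookup-spike-≢ m (suc (suc m)) (i′≢i ∘ sym))))
      notch-high-at-i : suc m ≤ m
      notch-high-at-i = subst (suc m ≤_) (lookup-spike-≡ i m (suc (suc m)))
        (Equivalence.from (F-preserves-threshold fixed sends (notch∈C m i))
                          (≤-trans (n≤1+n (suc m)) image-high-at-j))

  lower-injective : ∀ {i j} → lower 0 i ≡ lower 0 j → i ≡ j
  lower-injective = LowerCovers.incomparable (lower-covers 0) ∘ ≼-reflexive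

  permutational : (∀ m → DiagFixed m) → Permutational C φ
  permutational fixed = π , λ pa i →
    sym (≡-from-thresholds λ m → F-preserves-threshold (fixed m) (sends-π i m) pa)
    where
    lower-permutation : Σ[ π ∈ Permutation′ n ] (∀ i → Sends 0 i (π ⟨$⟩ʳ i))
    lower-permutation = permutation-of (lower∈C 0) lower-injective (lower-covers-permuted 0 (fixed 0))
    π : Permutation′ n
    π = proj₁ lower-permutation
    sends-π : ∀ i m → Sends m i (π ⟨$⟩ʳ i)
    sends-π i zero    = proj₂ lower-permutation i
    sends-π i (suc m) = Sends-suc (fixed m) (fixed (suc m)) (sends-π i m)

module OneDimensional {ℓ : Level} {C : Subset ℓ 1} {cl : ClosedMax C} {φ : El C → El C}
                      (aut : Is⊕Automorphism C φ cl) where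
  open ⊕-Automorphism {C = C} {cl = cl} {φ = φ} aut

  coordinate-injective : ∀ {u v : Vecℕ 1} → lookup u zero ≡ lookup v zero → u ≡ v
  coordinate-injective eq = lookup-ext λ { zero → eq }

  F-fixes : ∀ {a} (pa : C a) → F a pa ≡ a
  F-fixes {a} pa = <-rec FixedAt step (lookup a zero) pa refl
    where
    FixedAt : ℕ → Set ℓ
    FixedAt x = ∀ {a} (pa : C a) → lookup a zero ≡ x → F a pa ≡ a

    step : ∀ x → (∀ {y} → y < x → FixedAt y) → FixedAt x
    step x ih {a} pa a≡x with F-surjective pa
    ... | u , pu , Fu≡a with <-cmp (lookup u zero) x
    ...   | tri< u<x _ _ = trans (F-cong pa pu (trans (sym Fu≡a) (ih u<x pu refl))) Fu≡a
    ...   | tri≈ _ u≡x _ = trans (F-cong pa pu (coordinate-injective (trans a≡x (sym u≡x)))) Fu≡a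
    ...   | tri> _ _ x<u with m≤n⇒m<n∨m≡n Fa≤x
      where
      a≼u : a ≼ u
      a≼u zero = subst (_≤ lookup u zero) (sym a≡x) (<⇒≤ x<u)
      Fa≤x : lookup (F a pa) zero ≤ x
      Fa≤x = subst (lookup (F a pa) zero ≤_) (trans (Fu≡a at zero) a≡x) (F-mono pa pu a≼u zero)
    ...     | inj₁ Fa<x = F-injective (proj₂ (φ (a , pa))) pa (ih Fa<x (proj₂ (φ (a , pa))) refl)
    ...     | inj₂ Fa≡x = coordinate-injective (trans Fa≡x (sym a≡x))

  permutational : Permutational C φ
  permutational = Permutation.id , λ pa → λ { zero → F-fixes pa at zero }

very-full⇒𝟏∈C : ∀ {n} {C : Subset ℓ (suc (suc n))} → VeryFull C → ClosedMax C → C 𝟏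
very-full⇒𝟏∈C {C = C} very-full cl =
  subst C (spike-⊕-spike {i = zero} {j = suc zero} (λ ()) z≤n) (cl (𝟏-e∈C zero) (𝟏-e∈C (suc zero)))
  where
  𝟏-e∈C : ∀ i → C (spike i 0 1)
  𝟏-e∈C i = subst C (𝟏-e≡spike i) (proj₂ (very-full i))

mainTheorem16 : ∀ {ℓ : Level} (n : ℕ) (C : Subset ℓ n)
    → VeryFull C → ClosedAdd C → (cl : ClosedMax C)
    → (φ : El C → El C) → Is⊕Automorphism C φ cl
    → Σ[ r ∈ ℕ ] (1 ≤ r × Fixes C φ (const n r))
    → Permutational C φ
mainTheorem16 zero          C _         _          _  _ _   _ = Permutation.id , λ _ ()
mainTheorem16 (suc zero)    C _         _          cl φ aut _ =
  OneDimensional.permutational {C = C} {cl = cl} {φ = φ} aut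
mainTheorem16 (suc (suc n)) C very-full closed-add cl φ aut (suc r , _ , r-fixed) =
  permutational (all-diag-fixed r r-fixed)
  where
  open Staircase {C = C} {cl = cl} {φ = φ} aut very-full closed-add
                 (very-full⇒𝟏∈C {C = C} very-full cl)
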